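{- Let $\Delta$ be a pure simplicial complex of dimension $d\ge1$. If some labeling of the vertices of $\Delta$ by $1,\dots,n$ is a perfect elimination ordering, then there is some $(d-2)$-face $\sigma$ of $\Delta$ whose link $\mathrm{link}_\Delta(\sigma)$ is a chordal graph.
   Context: $\mathrm{link}_\Delta(\sigma)=\{\tau : \tau\cap\sigma=\emptyset,\ \tau\cup\sigma\in\Delta\}$; for a $(d-2)$-face it is a 1-dimensional complex (a graph). $[\sigma,i,j]_<$ denotes $\sigma\cup\{i,j\}$ with all vertices of $\sigma$ less than $i<j$. A labeling is a perfect elimination ordering of $\Delta$ if for every $(d-2)$-face $\sigma$ and vertices $\sigma<i<j<k$, $[\sigma,i,k]_<,[\sigma,j,k]_<\in\Delta$ implies $[\sigma,i,j]_<\in\Delta$. A graph is chordal if every cycle of length at least 4 has a chord. -}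

module Defs where

open import Data.Nat using (ℕ; suc; _+_; _≤_)
open import Data.Fin using (Fin; toℕ) renaming (_<_ to _<ᶠ_)
open import Data.Fin.Subset using (Subset; _∈_; _∉_; _⊆_; _∪_; ⁅_⁆; ∣_∣)
open import Data.Fin.Permutation using (Permutation′; _⟨$⟩ʳ_)
open import Data.Product using (Σ; ∃; _×_)
open import Data.Sum using (_⊎_)
open import Relation.Nullary using (¬_)
open import Relation.Unary using (Decidable)
open import Relation.Binary.PropositionalEquality using (_≡_; _≢_)
open import Function.Definitions using (Injective)

-- A finite simplicial complex whose vertex set is exactly Fin n
-- (faces are subsets of Fin n; the set of faces is decidable and
-- closed under taking subsets; every vertex is a face).
record SimplicialComplex (n : ℕ) : Set₁ where
  field
    Face        : Subset n → Set
    face?       : Decidable Face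
    downClosed  : ∀ {s t} → s ⊆ t → Face t → Face s
    vertexFace  : ∀ v → Face ⁅ v ⁆

open SimplicialComplex public

HasDimension : ∀ {n} → SimplicialComplex n → ℕ → Set
HasDimension Δ d =
  (∃ λ s → Face Δ s × ∣ s ∣ ≡ suc d) × (∀ s → Face Δ s → ∣ s ∣ ≤ suc d)

PureOfDim : ∀ {n} → SimplicialComplex n → ℕ → Set
PureOfDim Δ d = HasDimension Δ d ×
  (∀ s → Face Δ s → ∃ λ t → s ⊆ t × Face Δ t × ∣ t ∣ ≡ suc d)

-- σ is a (d-2)-face (for d ≥ 1): a face with d-1 vertices.
IsCodim2Face : ∀ {n} → SimplicialComplex n → ℕ → Subset n → Set
IsCodim2Face Δ d σ = Face Δ σ × suc ∣ σ ∣ ≡ d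

-- Perfect elimination ordering w.r.t. the labeling ℓ (vertex v gets label ℓ v;
-- comparisons of vertices are comparisons of their labels).
IsPEO : ∀ {n} → SimplicialComplex n → ℕ → Permutation′ n → Set
IsPEO {n} Δ d ℓ = ∀ σ → IsCodim2Face Δ d σ → ∀ (i j k : Fin n) →
  (∀ v → v ∈ σ → (ℓ ⟨$⟩ʳ v) <ᶠ (ℓ ⟨$⟩ʳ i)) →
  (ℓ ⟨$⟩ʳ i) <ᶠ (ℓ ⟨$⟩ʳ j) → (ℓ ⟨$⟩ʳ j) <ᶠ (ℓ ⟨$⟩ʳ k) →
  Face Δ (σ ∪ (⁅ i ⁆ ∪ ⁅ k ⁆)) → Face Δ (σ ∪ (⁅ j ⁆ ∪ ⁅ k ⁆)) →
  Face Δ (σ ∪ (⁅ i ⁆ ∪ ⁅ j ⁆))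

Link : ∀ {n} → SimplicialComplex n → Subset n → Subset n → Set
Link Δ σ τ = (∀ x → x ∈ τ → x ∉ σ) × Face Δ (τ ∪ σ)

LinkEdge : ∀ {n} → SimplicialComplex n → Subset n → Fin n → Fin n → Set
LinkEdge Δ σ u v = u ≢ v × Link Δ σ (⁅ u ⁆ ∪ ⁅ v ⁆)

Consecutive : (m : ℕ) → Fin m → Fin m → Set
Consecutive m i j = (toℕ j ≡ suc (toℕ i)) ⊎ (suc (toℕ i) ≡ m × toℕ j ≡ 0)

Chordal : ∀ {n} → (Fin n → Fin n → Set) → Set
Chordal {n} E = ∀ (m : ℕ) (c : Fin m → Fin n) → 4 ≤ m → Injective _≡_ _≡_ c →
  (∀ i j → Consecutive m i j → E (c i) (c j)) →
  ∃ λ i → ∃ λ j → i ≢ j × ¬ Consecutive m i j × ¬ Consecutive m j i × E (c i) (c j)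

module Submission where

-- Write L v for the label of the vertex v.  Call a face σ *below its link*
-- if every vertex w ∉ σ with σ ∪ {w} ∈ Δ has a larger label than every
-- vertex of σ.  The proof has two independent halves.
--
-- (1) Existence.  Start from any (d-2)-face (a subset of a facet).  If it
--     is not below its link, some addable w is smaller than some v ∈ σ;
--     exchanging v for w gives a face of the same size whose label sum is
--     strictly smaller.  Well-founded descent on the label sum therefore
--     ends in a (d-2)-face below its link.
-- (2) Chordality.  Let σ be a (d-2)-face below its link and take a cycle
--     of length ≥ 4 in link(σ).  Its vertex p of largest label has two
--     cycle-neighbours a, b with σ < a, b < p; the elimination condition
--     applied to the edges ap and bp yields the edge ab, and a, b are not
--     consecutive on the cycle because it has length ≥ 4.  So ab is a chord.

open import Defs
open import Data.Nat using (ℕ; _≤_; zero; suc; _+_; _<_; s≤s; _<?_)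
open import Data.Fin.Permutation using (Permutation′; _⟨$⟩ʳ_)
open import Data.Product using (∃; _×_; _,_; proj₁)
import Data.Nat.Properties as ℕ
open import Data.Nat.Induction using (<-wellFounded)
open import Induction.WellFounded using (Acc; acc)
open import Algebra.Properties.CommutativeSemigroup ℕ.+-commutativeSemigroup using (x∙yz≈y∙xz)
open import Data.Vec.Base using ([]; _∷_; here; there; _[_]≔_)
open import Data.List.Base using (allFin)
open import Data.List.Extrema.Nat using (argmax; f[xs]≤f[argmax])
open import Data.List.Membership.Propositional.Properties using (∈-allFin)
import Data.List.Relation.Unary.All as All
open import Data.Fin.Base using (Fin; toℕ; fromℕ; fromℕ<; inject₁)
  renaming (zero to fzero; suc to fsuc)
open import Data.Fin.Properties using (any?; toℕ-injective; toℕ<n; toℕ-fromℕ; toℕ-fromℕ<; toℕ-inject₁)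
open import Data.Fin.Subset using (Subset; _∈_; _∉_; _⊆_; _∪_; ⁅_⁆; ∣_∣; ⊥; inside; outside)
open import Data.Fin.Subset.Properties
  using (_∈?_; ⊥⊆; ∣⊥∣≡0; out⊆; in⊆in; ∪-comm; ∪-identityʳ; p⊆p∪q; q⊆p∪q; x∈p∪q⁻; x∈p∪q⁺; x∈⁅x⁆; x∈⁅y⁆⇒x≡y)
open import Data.Sum using (_⊎_; inj₁; inj₂)
open import Data.Empty using (⊥-elim)
open import Function.Base using (_∘_)
open import Function.Bundles using (Injection)
open import Function.Definitions using (Injective)
open import Function.Properties.Inverse using (↔⇒↣)
open import Relation.Nullary using (¬_; Dec; yes; no)
open import Relation.Nullary.Decidable using (_×-dec_; ¬?)
open import Relation.Binary.Definitions using (tri<; tri≈; tri>)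
open import Relation.Binary.PropositionalEquality using (_≡_; _≢_; refl; sym; trans; cong; subst; module ≡-Reasoning)
open ≡-Reasoning

weight : ∀ {n} → (Fin n → ℕ) → Subset n → ℕ
weight f []            = 0
weight f (inside ∷ s)  = f fzero + weight (f ∘ fsuc) s
weight f (outside ∷ s) = weight (f ∘ fsuc) s

∣_∣≡weight1 : ∀ {n} (s : Subset n) → ∣ s ∣ ≡ weight (λ _ → 1) s
∣ []          ∣≡weight1 = refl
∣ inside ∷ s  ∣≡weight1 = cong suc ∣ s ∣≡weight1
∣ outside ∷ s ∣≡weight1 = ∣ s ∣≡weight1

weight-add : ∀ {n} f (s : Subset n) w → w ∉ s → weight f (s ∪ ⁅ w ⁆) ≡ f w + weight f s
weight-add f (inside  ∷ s) fzero    w∉s = ⊥-elim (w∉s here)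
weight-add f (outside ∷ s) fzero    _   = cong (λ t → f fzero + weight (f ∘ fsuc) t) (∪-identityʳ s)
weight-add f (inside  ∷ s) (fsuc w) w∉s = begin
  f fzero + weight (f ∘ fsuc) (s ∪ ⁅ w ⁆)  ≡⟨ cong (f fzero +_) (weight-add (f ∘ fsuc) s w (w∉s ∘ there)) ⟩
  f fzero + (f (fsuc w) + weight (f ∘ fsuc) s) ≡⟨ x∙yz≈y∙xz (f fzero) (f (fsuc w)) _ ⟩
  f (fsuc w) + (f fzero + weight (f ∘ fsuc) s) ∎
weight-add f (outside ∷ s) (fsuc w) w∉s = weight-add (f ∘ fsuc) s w (w∉s ∘ there)

weight-remove : ∀ {n} f (s : Subset n) v → v ∈ s → weight f s ≡ f v + weight f (s [ v ]≔ outside)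
weight-remove f (inside  ∷ s) fzero    _            = refl
weight-remove f (inside  ∷ s) (fsuc v) (there v∈s) = begin
  f fzero + weight (f ∘ fsuc) s                        ≡⟨ cong (f fzero +_) (weight-remove (f ∘ fsuc) s v v∈s) ⟩
  f fzero + (f (fsuc v) + weight (f ∘ fsuc) (s [ v ]≔ outside)) ≡⟨ x∙yz≈y∙xz (f fzero) (f (fsuc v)) _ ⟩
  f (fsuc v) + (f fzero + weight (f ∘ fsuc) (s [ v ]≔ outside)) ∎
weight-remove f (outside ∷ s) (fsuc v) (there v∈s) = weight-remove (f ∘ fsuc) s v v∈s

remove-⊆ : ∀ {n} (s : Subset n) v → s [ v ]≔ outside ⊆ s
remove-⊆ (b ∷ s) fzero    (there x∈s) = there x∈s
remove-⊆ (b ∷ s) (fsuc v) here        = here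
remove-⊆ (b ∷ s) (fsuc v) (there x∈s) = there (remove-⊆ s v x∈s)

exchange : ∀ {n} → Subset n → Fin n → Fin n → Subset n
exchange s v w = (s ∪ ⁅ w ⁆) [ v ]≔ outside

weight-exchange : ∀ {n} f (s : Subset n) {v w} → v ∈ s → w ∉ s →
  f v + weight f (exchange s v w) ≡ f w + weight f s
weight-exchange f s {v} {w} v∈s w∉s = begin
  f v + weight f (exchange s v w) ≡⟨ weight-remove f (s ∪ ⁅ w ⁆) v (p⊆p∪q ⁅ w ⁆ v∈s) ⟨
  weight f (s ∪ ⁅ w ⁆)             ≡⟨ weight-add f s w w∉s ⟩
  f w + weight f s                ∎

∣exchange∣ : ∀ {n} (s : Subset n) {v w} → v ∈ s → w ∉ s → ∣ exchange s v w ∣ ≡ ∣ s ∣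
∣exchange∣ s {v} {w} v∈s w∉s = ℕ.suc-injective (begin
  suc ∣ exchange s v w ∣              ≡⟨ cong suc ∣ exchange s v w ∣≡weight1 ⟩
  1 + weight (λ _ → 1) (exchange s v w) ≡⟨ weight-exchange (λ _ → 1) s v∈s w∉s ⟩
  1 + weight (λ _ → 1) s              ≡⟨ cong suc ∣ s ∣≡weight1 ⟨
  suc ∣ s ∣                           ∎)

subsetOfSize : ∀ {n} k (s : Subset n) → k ≤ ∣ s ∣ → ∃ λ t → t ⊆ s × ∣ t ∣ ≡ k
subsetOfSize {n} zero s _ = ⊥ , ⊥⊆ , ∣⊥∣≡0 n
subsetOfSize (suc k) (outside ∷ s) k<∣s∣   with subsetOfSize (suc k) s k<∣s∣
... | t , t⊆s , ∣t∣ = outside ∷ t , out⊆ t⊆s , ∣t∣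
subsetOfSize (suc k) (inside ∷ s)  (s≤s k≤∣s∣) with subsetOfSize k s k≤∣s∣
... | t , t⊆s , ∣t∣ = inside ∷ t , in⊆in t⊆s , cong suc ∣t∣

-- Cyclic successor on positions 0, …, m-1 in ℕ; `Consecutive m i j` is
-- by definition `CyclicSucc m (toℕ i) (toℕ j)`.
CyclicSucc : ℕ → ℕ → ℕ → Set
CyclicSucc m x y = (y ≡ suc x) ⊎ (suc x ≡ m × y ≡ 0)

twoStepsApart : ∀ {m a p b} → 4 ≤ m → CyclicSucc m a p → CyclicSucc m p b →
  a ≢ b × ¬ CyclicSucc m a b × ¬ CyclicSucc m b a
-- a, a+1, a+2
twoStepsApart (s≤s (s≤s (s≤s (s≤s _)))) (inj₁ refl) (inj₁ refl) =
  (λ ()) , (λ { (inj₁ ()) ; (inj₂ (_ , ())) }) , (λ { (inj₁ ()) ; (inj₂ (() , refl)) })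
-- m-2, m-1, 0
twoStepsApart (s≤s (s≤s (s≤s (s≤s _)))) (inj₁ refl) (inj₂ (refl , refl)) =
  (λ ()) , (λ { (inj₁ ()) ; (inj₂ (() , _)) }) , (λ { (inj₁ ()) ; (inj₂ (() , _)) })
-- m-1, 0, 1
twoStepsApart (s≤s (s≤s (s≤s (s≤s _)))) (inj₂ (refl , refl)) (inj₁ refl) =
  (λ ()) , (λ { (inj₁ ()) ; (inj₂ (_ , ())) }) , (λ { (inj₁ ()) ; (inj₂ (() , _)) })
-- m-1, 0, 0: forces m = 1
twoStepsApart (s≤s (s≤s (s≤s (s≤s _)))) (inj₂ (refl , refl)) (inj₂ (() , _))

predecessor : ∀ {m} (p : Fin m) → ∃ λ a → Consecutive m a p
predecessor {suc M} fzero    = fromℕ M , inj₂ (cong suc (toℕ-fromℕ M) , refl)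
predecessor         (fsuc i) = inject₁ i , inj₁ (cong suc (sym (toℕ-inject₁ i)))

successor : ∀ {m} (p : Fin m) → ∃ λ b → Consecutive m p b
successor {suc M} p with suc (toℕ p) <? suc M
... | yes p+1<m = fromℕ< p+1<m , inj₁ (toℕ-fromℕ< p+1<m)
... | no  p+1≮m = fzero , inj₂ (ℕ.≤-antisym (toℕ<n p) (ℕ.≮⇒≥ p+1≮m) , refl)

maximumAt : ∀ {m} → Fin m → (g : Fin m → ℕ) → ∃ λ p → ∀ i → g i ≤ g p
maximumAt {m} p₀ g = argmax g p₀ (allFin m) , λ i → All.lookup (f[xs]≤f[argmax] p₀ (allFin m)) (∈-allFin i)

module LinkGraph {n} (Δ : SimplicialComplex n) (σ : Subset n) where

  linkEdge-sym : ∀ {u v} → LinkEdge Δ σ u v → LinkEdge Δ σ v u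
  linkEdge-sym {u} {v} (u≢v , link) = u≢v ∘ sym , subst (Link Δ σ) (∪-comm ⁅ u ⁆ ⁅ v ⁆) link

  linkEdge⇒face : ∀ {u v} → LinkEdge Δ σ u v → Face Δ (σ ∪ (⁅ u ⁆ ∪ ⁅ v ⁆))
  linkEdge⇒face {u} {v} (_ , _ , F) = subst (Face Δ) (∪-comm (⁅ u ⁆ ∪ ⁅ v ⁆) σ) F

  face⇒linkEdge : ∀ {u v} → u ≢ v → u ∉ σ → v ∉ σ → Face Δ (σ ∪ (⁅ u ⁆ ∪ ⁅ v ⁆)) → LinkEdge Δ σ u v
  face⇒linkEdge {u} {v} u≢v u∉σ v∉σ F = u≢v , disjoint , subst (Face Δ) (∪-comm σ (⁅ u ⁆ ∪ ⁅ v ⁆)) F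
    where
    disjoint : ∀ x → x ∈ ⁅ u ⁆ ∪ ⁅ v ⁆ → x ∉ σ
    disjoint x x∈uv with x∈p∪q⁻ ⁅ u ⁆ ⁅ v ⁆ x∈uv
    ... | inj₁ x∈u rewrite x∈⁅y⁆⇒x≡y u x∈u = u∉σ
    ... | inj₂ x∈v rewrite x∈⁅y⁆⇒x≡y v x∈v = v∉σ

  linkEdge⇒vertex : ∀ {u v} → LinkEdge Δ σ u v → u ∉ σ × Face Δ (σ ∪ ⁅ u ⁆)
  linkEdge⇒vertex {u} {v} e@(_ , disjoint , _) =
    disjoint u (x∈p∪q⁺ (inj₁ (x∈⁅x⁆ u))) , downClosed Δ σu⊆σuv (linkEdge⇒face e)
    where
    σu⊆σuv : σ ∪ ⁅ u ⁆ ⊆ σ ∪ (⁅ u ⁆ ∪ ⁅ v ⁆)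
    σu⊆σuv x∈ with x∈p∪q⁻ σ ⁅ u ⁆ x∈
    ... | inj₁ x∈σ = p⊆p∪q _ x∈σ
    ... | inj₂ x∈u = q⊆p∪q σ _ (p⊆p∪q ⁅ v ⁆ x∈u)

module Labeling {n} (Δ : SimplicialComplex n) (L : Fin n → ℕ) (L-injective : Injective _≡_ _≡_ L) where

  BelowLink : Subset n → Set
  BelowLink σ = ∀ w → w ∉ σ → Face Δ (σ ∪ ⁅ w ⁆) → ∀ v → v ∈ σ → L v < L w

  Improvement : Subset n → Set
  Improvement σ = ∃ λ w → ∃ λ v → (w ∉ σ × Face Δ (σ ∪ ⁅ w ⁆)) × (v ∈ σ × L w < L v)

  improvement? : ∀ σ → Dec (Improvement σ)
  improvement? σ = any? λ w → any? λ v →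
    (¬? (w ∈? σ) ×-dec face? Δ (σ ∪ ⁅ w ⁆)) ×-dec ((v ∈? σ) ×-dec (L w <? L v))

  noImprovement⇒belowLink : ∀ σ → ¬ Improvement σ → BelowLink σ
  noImprovement⇒belowLink σ none w w∉σ F v v∈σ with ℕ.<-cmp (L v) (L w)
  ... | tri< Lv<Lw _ _ = Lv<Lw
  ... | tri≈ _ Lv≡Lw _ = ⊥-elim (w∉σ (subst (_∈ σ) (L-injective Lv≡Lw) v∈σ))
  ... | tri> _ _ Lw<Lv = ⊥-elim (none (w , v , (w∉σ , F) , (v∈σ , Lw<Lv)))

  improve : ∀ σ → Improvement σ →
    ∃ λ σ′ → Face Δ σ′ × ∣ σ′ ∣ ≡ ∣ σ ∣ × weight L σ′ < weight L σ
  improve σ (w , v , (w∉σ , F) , (v∈σ , Lw<Lv)) =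
    exchange σ v w , downClosed Δ (remove-⊆ (σ ∪ ⁅ w ⁆) v) F , ∣exchange∣ σ v∈σ w∉σ , smaller
    where
    smaller : weight L (exchange σ v w) < weight L σ
    smaller = ℕ.+-cancelˡ-< (L v) _ _
      (subst (_< L v + weight L σ) (sym (weight-exchange L σ v∈σ w∉σ)) (ℕ.+-monoˡ-< (weight L σ) Lw<Lv))

  lowerFace : ∀ σ → Face Δ σ → ∃ λ τ → Face Δ τ × ∣ τ ∣ ≡ ∣ σ ∣ × BelowLink τ
  lowerFace σ F = descend σ F (<-wellFounded (weight L σ))
    where
    descend : ∀ σ → Face Δ σ → Acc _<_ (weight L σ) → ∃ λ τ → Face Δ τ × ∣ τ ∣ ≡ ∣ σ ∣ × BelowLink τ
    descend σ F (acc smaller) with improvement? σ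
    ... | no none = σ , F , refl , noImprovement⇒belowLink σ none
    ... | yes imp with improve σ imp
    ... | σ′ , F′ , ∣σ′∣ , lighter with descend σ′ F′ (smaller lighter)
    ... | τ , Fτ , ∣τ∣ , below = τ , Fτ , trans ∣τ∣ ∣σ′∣ , below

  codim2FaceBelowLink : ∀ {d} → HasDimension Δ (suc d) → ∃ λ σ → IsCodim2Face Δ (suc d) σ × BelowLink σ
  codim2FaceBelowLink {d} ((facet , facet-face , ∣facet∣) , _)
    with subsetOfSize d facet (subst (d ≤_) (sym ∣facet∣) (ℕ.m≤n+m d 2))
  ... | σ₀ , σ₀⊆facet , ∣σ₀∣ with lowerFace σ₀ (downClosed Δ σ₀⊆facet facet-face)
  ... | σ , σ-face , ∣σ∣ , below = σ , (σ-face , cong suc (trans ∣σ∣ ∣σ₀∣)) , below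

module Elimination {n} (Δ : SimplicialComplex n) (d : ℕ) (ℓ : Permutation′ n) (peo : IsPEO Δ d ℓ) where

  label : Fin n → ℕ
  label v = toℕ (ℓ ⟨$⟩ʳ v)

  label-injective : Injective _≡_ _≡_ label
  label-injective = Injection.injective (↔⇒↣ ℓ) ∘ toℕ-injective

  open Labeling Δ label label-injective public

  module _ (σ : Subset n) (σ-face : IsCodim2Face Δ d σ) (below : BelowLink σ) where
    open LinkGraph Δ σ

    aboveσ : ∀ {u v} → LinkEdge Δ σ u v → ∀ x → x ∈ σ → label x < label u
    aboveσ e with linkEdge⇒vertex e
    ... | u∉σ , σu-face = below _ u∉σ σu-face

    eliminate : ∀ {x y z} → label x < label y → label y < label z →
      LinkEdge Δ σ x z → LinkEdge Δ σ y z → LinkEdge Δ σ x y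
    eliminate x<y y<z xz yz =
      face⇒linkEdge (λ { refl → ℕ.<-irrefl refl x<y })
        (proj₁ (linkEdge⇒vertex xz)) (proj₁ (linkEdge⇒vertex yz))
        (peo σ σ-face _ _ _ (aboveσ xz) x<y y<z (linkEdge⇒face xz) (linkEdge⇒face yz))

    closeWedge : ∀ {x y z} → x ≢ y → label x < label z → label y < label z →
      LinkEdge Δ σ x z → LinkEdge Δ σ y z → LinkEdge Δ σ x y
    closeWedge {x} {y} x≢y x<z y<z xz yz with ℕ.<-cmp (label x) (label y)
    ... | tri< x<y _ _ = eliminate x<y y<z xz yz
    ... | tri≈ _ x≡y _ = ⊥-elim (x≢y (label-injective x≡y))
    ... | tri> _ _ y<x = linkEdge-sym (eliminate y<x x<z yz xz)

    -- The cycle-neighbours a, b of the largest vertex p of a cycle span a chord.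
    linkChordal : Chordal (LinkEdge Δ σ)
    linkChordal (suc m) c 4≤m c-injective cycleEdge
      with maximumAt fzero (label ∘ c)
    ... | p , p-max with predecessor p | successor p
    ... | a , a→p | b , p→b with twoStepsApart 4≤m a→p p→b
    ... | a≢b , a↛b , b↛a =
      a , b , a≢b ∘ cong toℕ , a↛b , b↛a ,
      closeWedge (a≢b ∘ cong toℕ ∘ c-injective) (belowTop ap) (belowTop bp) ap bp
      where
      ap : LinkEdge Δ σ (c a) (c p)
      ap = cycleEdge a p a→p
      bp : LinkEdge Δ σ (c b) (c p)
      bp = linkEdge-sym (cycleEdge p b p→b)
      belowTop : ∀ {i} → LinkEdge Δ σ (c i) (c p) → label (c i) < label (c p)
      belowTop {i} (ci≢cp , _) = ℕ.≤∧≢⇒< (p-max i) (ci≢cp ∘ label-injective)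

mainTheorem8 : ∀ {n : ℕ} (Δ : SimplicialComplex n) (d : ℕ) → 1 ≤ d → PureOfDim Δ d →
    (∃ λ (ℓ : Permutation′ n) → IsPEO Δ d ℓ) →
    ∃ λ σ → IsCodim2Face Δ d σ × Chordal (LinkEdge Δ σ)
mainTheorem8 Δ (suc d) (s≤s _) (dimension , _) (ℓ , peo) =
  let open Elimination Δ (suc d) ℓ peo
      σ , σ-face , below = codim2FaceBelowLink dimension
  in σ , σ-face , linkChordal σ σ-face below
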